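{- For every $\epsilon > 0$ and every $Q \in \mathbb{N}$, if $A,B \subseteq \mathbb{Z}/Q\mathbb{Z}$ are nonempty subsets and $B$ intersects every coset of every subgroup of $\mathbb{Z}/Q\mathbb{Z}$ of index at most $\epsilon^{ -1}$, then either \[ |A+B| > |A| + |B| - \epsilon Q \] or $A+B = \mathbb{Z}/Q\mathbb{Z}$.
   Formalization: The parameter ε ranges over the positive rationals. -}

module Defs where

open import Data.Nat using (ℕ; NonZero; _*_)
open import Data.Nat.DivMod using (_mod_)
open import Data.Fin using (Fin; toℕ; _≟_)
open import Data.Fin.Properties using (any?)
open import Data.Fin.Subset using (Subset; _∈_; ∣_∣)
open import Data.Fin.Subset.Properties using (_∈?_)
open import Data.Vec using (tabulate)
open import Data.Product using (∃; ∃₂; _×_; _,_)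
open import Relation.Nullary using (does)
open import Relation.Nullary.Decidable using (_×-dec_)
open import Relation.Binary.PropositionalEquality using (_≡_)
open import Data.Integer using (+_)
open import Data.Rational using (ℚ; _/_)

-- The cyclic group ℤ/Qℤ is represented by Fin Q (residues 0..Q-1).
module _ (Q : ℕ) .{{_ : NonZero Q}} where

  addQ : Fin Q → Fin Q → Fin Q
  addQ a b = (toℕ a Data.Nat.+ toℕ b) mod Q

  negQ : Fin Q → Fin Q
  negQ a = (Q Data.Nat.∸ toℕ a) mod Q

  zeroQ : Fin Q
  zeroQ = 0 mod Q

  sumset : Subset Q → Subset Q → Subset Q
  sumset A B = tabulate λ x →
    does (any? λ a → any? λ b →
      (a ∈? A) ×-dec ((b ∈? B) ×-dec (addQ a b ≟ x)))

  record IsSubgroup (H : Subset Q) : Set where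
    field
      has-zero : zeroQ ∈ H
      add-closed : ∀ {a b} → a ∈ H → b ∈ H → addQ a b ∈ H
      neg-closed : ∀ {a} → a ∈ H → negQ a ∈ H

  HasIndex : Subset Q → ℕ → Set
  HasIndex H k = ∣ H ∣ * k ≡ Q

  MeetsCoset : Subset Q → Subset Q → Fin Q → Set
  MeetsCoset B H x = ∃₂ λ b h → b ∈ B × h ∈ H × b ≡ addQ x h

ℕtoℚ : ℕ → ℚ
ℕtoℚ n = + n / 1

-- Dyson's e-transform (A, B) ↦ (A ∩ (B − c), (A + c) ∪ B), applied while some translate A + c
-- meets B without lying in B, does not decrease |A| + |B|, strictly shrinks A, enlarges B and
-- does not enlarge A + B.  It ends in a pair (A*, B*) in which every difference of elements of A*
-- stabilises B*, so |A*| is at most the order of the stabiliser S of B*.  If |A*| < εQ, then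
-- |A + B| ≥ |B*| > |A| + |B| − εQ.  Otherwise |S| ≥ εQ, so by Lagrange S has index at most 1/ε;
-- then B ⊆ B* meets every coset of S, and B*, being a union of S-cosets, is all of ℤ/Qℤ, hence
-- so are A* + B* and A + B.
module Submission where

open import Algebra.Bundles using (AbelianGroup; CommutativeMonoid)
open import Algebra.Core using (Op₁; Op₂)
open import Algebra.Structures using (IsAbelianGroup)
open import Data.Fin using (Fin; zero; suc; toℕ; _≟_)
open import Data.Fin.Properties using (0≢1+n; suc-injective; toℕ-fromℕ<; toℕ-injective; toℕ<n; any?; all?)
open import Data.Fin.Subset
  using (Subset; inside; outside; _∈_; _∉_; _⊆_; _∩_; _∪_; _─_; ∣_∣; ⊤; Nonempty)
open import Data.Fin.Subset.Properties
  using (_∈?_; nonempty?; Empty-unique; ∣⊥∣≡0; ∈⊤; ⊆⊤; ∣⊤∣≡n; ⊆-refl; ⊆-trans; ⊆-antisym; drop-∷-⊆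
        ; p⊆q⇒∣p∣≤∣q∣; p⊂q⇒∣p∣<∣q∣; p∩q⊆p; q⊆p∪q; x∈p∩q⁺; x∈p∩q⁻; x∈p∪q⁻
        ; x∈p∧x∉q⇒x∈p─q; p─q⊆p; p∩q≢∅⇒∣p─q∣<∣p∣; x∈p∧x≢y⇒x∈p-y; x∈p⇒∣p-x∣<∣p∣)
open import Data.Nat.Base as ℕ using (ℕ; z≤n; NonZero)
import Data.Nat.Divisibility as Divisibility
open import Data.Nat.Induction using (<-wellFounded)
import Data.Nat.Properties as ℕ
open import Data.Empty using (⊥-elim)
open import Data.Product.Base using (∃; ∃₂; _×_; _,_; proj₁; proj₂)
open import Data.Sum.Base using (_⊎_; inj₁; inj₂)
import Data.Sum.Base as Sum
open import Data.Vec.Base using ([]; _∷_; tabulate; here; there)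
open import Data.Vec.Properties using (lookup∘tabulate; []=⇒lookup; lookup⇒[]=)
open import Function.Base using (_∘_)
open import Function.Definitions using (Injective)
open import Induction.WellFounded using (Acc; acc)
open import Level using (0ℓ)
open import Relation.Binary.PropositionalEquality
  using (_≡_; refl; sym; trans; cong; cong₂; subst; isEquivalence; module ≡-Reasoning)
open import Relation.Nullary using (¬_; Dec; yes; no; does)
open import Relation.Nullary.Decidable
  using (dec-true; decidable-stable; toSum; _×-dec_; _→-dec_; ¬?)
open import Relation.Unary using (Pred; Decidable)

module _ where
  open import Data.Nat.Base using (_+_; _≤_; _<_)
  open import Data.Nat.Properties using (+-suc; module ≤-Reasoning)
  open import Data.Fin.Subset using (_-_)

  fromDec : ∀ {n} {P : Pred (Fin n) 0ℓ} → Decidable P → Subset n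
  fromDec P? = tabulate (does ∘ P?)

  ∈-fromDec⁺ : ∀ {n} {P : Pred (Fin n) 0ℓ} (P? : Decidable P) {x} → P x → x ∈ fromDec P?
  ∈-fromDec⁺ P? {x} px = lookup⇒[]= x _ (trans (lookup∘tabulate _ x) (dec-true (P? x) px))

  ∈-fromDec⁻ : ∀ {n} {P : Pred (Fin n) 0ℓ} (P? : Decidable P) {x} → x ∈ fromDec P? → P x
  ∈-fromDec⁻ P? {x} x∈ with P? x | trans (sym (lookup∘tabulate _ x)) ([]=⇒lookup x∈)
  ... | yes px | _  = px
  ... | no  _  | ()

  injective⇒∣p∣≤∣q∣ : ∀ {m n} {p : Subset m} {q : Subset n} (f : Fin m → Fin n) →
                      Injective _≡_ _≡_ f → (∀ {x} → x ∈ p → f x ∈ q) → ∣ p ∣ ≤ ∣ q ∣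
  injective⇒∣p∣≤∣q∣ {p = []}          f f-inj f[p]⊆q = z≤n
  injective⇒∣p∣≤∣q∣ {p = outside ∷ p} f f-inj f[p]⊆q =
    injective⇒∣p∣≤∣q∣ (f ∘ suc) (suc-injective ∘ f-inj) (f[p]⊆q ∘ there)
  injective⇒∣p∣≤∣q∣ {p = inside ∷ p} {q} f f-inj f[p]⊆q = begin-strict
    ∣ p ∣          ≤⟨ injective⇒∣p∣≤∣q∣ (f ∘ suc) (suc-injective ∘ f-inj) f[p]⊆q-f0 ⟩
    ∣ q - f zero ∣ <⟨ x∈p⇒∣p-x∣<∣p∣ (f[p]⊆q here) ⟩
    ∣ q ∣          ∎
    where
    open ≤-Reasoning
    f[p]⊆q-f0 : ∀ {x} → x ∈ p → f (suc x) ∈ q - f zero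
    f[p]⊆q-f0 x∈p = x∈p∧x≢y⇒x∈p-y (f[p]⊆q (there x∈p)) (0≢1+n ∘ sym ∘ f-inj)

  ∣p∩q∣+∣p∪q∣≡∣p∣+∣q∣ : ∀ {n} (p q : Subset n) → ∣ p ∩ q ∣ + ∣ p ∪ q ∣ ≡ ∣ p ∣ + ∣ q ∣
  ∣p∩q∣+∣p∪q∣≡∣p∣+∣q∣ []            []            = refl
  ∣p∩q∣+∣p∪q∣≡∣p∣+∣q∣ (inside  ∷ p) (inside  ∷ q) =
    cong ℕ.suc (trans (+-suc _ _) (trans (cong ℕ.suc (∣p∩q∣+∣p∪q∣≡∣p∣+∣q∣ p q)) (sym (+-suc _ _))))
  ∣p∩q∣+∣p∪q∣≡∣p∣+∣q∣ (inside  ∷ p) (outside ∷ q) =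
    trans (+-suc _ _) (cong ℕ.suc (∣p∩q∣+∣p∪q∣≡∣p∣+∣q∣ p q))
  ∣p∩q∣+∣p∪q∣≡∣p∣+∣q∣ (outside ∷ p) (inside  ∷ q) =
    trans (+-suc _ _) (trans (cong ℕ.suc (∣p∩q∣+∣p∪q∣≡∣p∣+∣q∣ p q)) (sym (+-suc _ _)))
  ∣p∩q∣+∣p∪q∣≡∣p∣+∣q∣ (outside ∷ p) (outside ∷ q) = ∣p∩q∣+∣p∪q∣≡∣p∣+∣q∣ p q

  q⊆p⇒∣p∣≡∣p─q∣+∣q∣ : ∀ {n} {p q : Subset n} → q ⊆ p → ∣ p ∣ ≡ ∣ p ─ q ∣ + ∣ q ∣
  q⊆p⇒∣p∣≡∣p─q∣+∣q∣ {p = []}          {[]}          _   = refl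
  q⊆p⇒∣p∣≡∣p─q∣+∣q∣ {p = inside  ∷ p} {outside ∷ q} q⊆p = cong ℕ.suc (q⊆p⇒∣p∣≡∣p─q∣+∣q∣ (drop-∷-⊆ q⊆p))
  q⊆p⇒∣p∣≡∣p─q∣+∣q∣ {p = outside ∷ p} {outside ∷ q} q⊆p = q⊆p⇒∣p∣≡∣p─q∣+∣q∣ (drop-∷-⊆ q⊆p)
  q⊆p⇒∣p∣≡∣p─q∣+∣q∣ {p = inside  ∷ p} {inside  ∷ q} q⊆p =
    trans (cong ℕ.suc (q⊆p⇒∣p∣≡∣p─q∣+∣q∣ (drop-∷-⊆ q⊆p))) (sym (+-suc _ _))
  q⊆p⇒∣p∣≡∣p─q∣+∣q∣ {p = outside ∷ p} {inside  ∷ q} q⊆p with q⊆p here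
  ... | ()

  x∈p─q⇒x∉q : ∀ {n} {x : Fin n} (p q : Subset n) → x ∈ p ─ q → x ∉ q
  x∈p─q⇒x∉q (_ ∷ p) (_ ∷ q) (there x∈p─q) (there x∈q) = x∈p─q⇒x∉q p q x∈p─q x∈q

module FiniteAbelianGroup {n : ℕ} {_∙_ : Op₂ (Fin n)} {ε : Fin n} {_⁻¹ : Op₁ (Fin n)}
                          (isAbelianGroup : IsAbelianGroup _≡_ _∙_ ε _⁻¹) where

  open import Data.Nat.Base using (_≤_; _<_)
  open import Data.Nat.Divisibility using (_∣_; _∣0; ∣-reflexive; ∣m∣n⇒∣m+n)
  open import Data.Nat.Properties using (≤-refl; ≤-trans; ≤-antisym; +-monoˡ-≤; module ≤-Reasoning)

  private
    abelianGroup : AbelianGroup 0ℓ 0ℓ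
    abelianGroup = record { isAbelianGroup = isAbelianGroup }

  open AbelianGroup abelianGroup using (assoc; comm; identityʳ; inverseʳ; commutativeSemigroup)
  open import Algebra.Properties.AbelianGroup abelianGroup
    using (∙-cancelˡ; ∙-cancelʳ; //-rightDividesˡ; //-rightDividesʳ; \\-leftDividesˡ
          ; ε⁻¹≈ε; ⁻¹-involutive; ⁻¹-∙-comm; ⁻¹-anti-homo‿-)
  open import Algebra.Properties.CommutativeSemigroup commutativeSemigroup
    using (x∙yz≈y∙xz; x∙yz≈z∙xy; xy∙z≈xz∙y)

  infixl 6 _+_
  infix  9 -_
  infixl 8 _⊕_ _⊖_

  _+_ : Op₂ (Fin n)
  _+_ = _∙_

  -_ : Op₁ (Fin n)
  - x = x ⁻¹

  0# : Fin n
  0# = ε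

  +ˡ-injective : ∀ c → Injective _≡_ _≡_ (c +_)
  +ˡ-injective c = ∙-cancelˡ c _ _

  +ʳ-injective : ∀ c → Injective _≡_ _≡_ (_+ c)
  +ʳ-injective c = ∙-cancelʳ c _ _

  _⊖_ : Subset n → Fin n → Subset n
  p ⊖ c = fromDec λ x → x + c ∈? p

  _⊕_ : Subset n → Fin n → Subset n
  p ⊕ c = p ⊖ - c

  ∈-⊖⁺ : ∀ {p c x} → x + c ∈ p → x ∈ p ⊖ c
  ∈-⊖⁺ {p} {c} = ∈-fromDec⁺ (λ x → x + c ∈? p)

  ∈-⊖⁻ : ∀ {p c x} → x ∈ p ⊖ c → x + c ∈ p
  ∈-⊖⁻ {p} {c} = ∈-fromDec⁻ (λ x → x + c ∈? p)

  ∣p⊖c∣≡∣p∣ : ∀ p c → ∣ p ⊖ c ∣ ≡ ∣ p ∣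
  ∣p⊖c∣≡∣p∣ p c = ≤-antisym
    (injective⇒∣p∣≤∣q∣ (_+ c) (+ʳ-injective c) ∈-⊖⁻)
    (injective⇒∣p∣≤∣q∣ (_+ - c) (+ʳ-injective (- c))
      (λ {x} x∈p → ∈-⊖⁺ (subst (_∈ p) (sym (//-rightDividesˡ c x)) x∈p)))

  IsSum : Subset n → Subset n → Pred (Fin n) 0ℓ
  IsSum A B x = ∃₂ λ a b → a ∈ A × b ∈ B × a + b ≡ x

  isSum? : ∀ A B → Decidable (IsSum A B)
  isSum? A B x = any? λ a → any? λ b → a ∈? A ×-dec b ∈? B ×-dec a + b ≟ x

  sumset : Subset n → Subset n → Subset n
  sumset A B = fromDec (isSum? A B)

  ∈-sumset⁺ : ∀ {A B a b} → a ∈ A → b ∈ B → a + b ∈ sumset A B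
  ∈-sumset⁺ {A} {B} a∈A b∈B = ∈-fromDec⁺ (isSum? A B) (_ , _ , a∈A , b∈B , refl)

  ∈-sumset⁻ : ∀ {A B x} → x ∈ sumset A B → IsSum A B x
  ∈-sumset⁻ {A} {B} = ∈-fromDec⁻ (isSum? A B)

  ∣B∣≤∣sumset∣ : ∀ {A B} → Nonempty A → ∣ B ∣ ≤ ∣ sumset A B ∣
  ∣B∣≤∣sumset∣ (a , a∈A) = injective⇒∣p∣≤∣q∣ (a +_) (+ˡ-injective a) (∈-sumset⁺ a∈A)

  ⊤⊆sumset : ∀ {A B} → Nonempty A → ⊤ ⊆ B → ⊤ ⊆ sumset A B
  ⊤⊆sumset (a , a∈A) ⊤⊆B {x} _ = subst (_∈ _) (\\-leftDividesˡ a x) (∈-sumset⁺ a∈A (⊤⊆B ∈⊤))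

  record IsSubgroup (H : Subset n) : Set where
    field
      has-zero   : 0# ∈ H
      add-closed : ∀ {a b} → a ∈ H → b ∈ H → a + b ∈ H
      neg-closed : ∀ {a} → a ∈ H → - a ∈ H

  Periodic : Subset n → Subset n → Set
  Periodic H X = ∀ {x h} → x ∈ X → h ∈ H → x + h ∈ X

  module _ {H : Subset n} (H-subgroup : IsSubgroup H) where
    open IsSubgroup H-subgroup

    coset⊆ : ∀ {X x} → Periodic H X → x ∈ X → H ⊕ x ⊆ X
    coset⊆ {X} {x} X-periodic x∈X {y} y∈H⊕x =
      subst (_∈ X) (trans (comm x (y + - x)) (//-rightDividesˡ x y)) (X-periodic x∈X (∈-⊖⁻ y∈H⊕x))

    periodic─coset : ∀ {X} x → Periodic H X → Periodic H (X ─ (H ⊕ x))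
    periodic─coset {X} x X-periodic {y} {h} y∈X─C h∈H =
      x∈p∧x∉q⇒x∈p─q (X-periodic (p─q⊆p X (H ⊕ x) y∈X─C) h∈H) y+h∉C
      where
      y+h∉C : y + h ∉ H ⊕ x
      y+h∉C y+h∈C = x∈p─q⇒x∉q X (H ⊕ x) y∈X─C (∈-⊖⁺ (subst (_∈ H) y+h-x-h≡y-x
        (add-closed (∈-⊖⁻ y+h∈C) (neg-closed h∈H))))
        where
        y+h-x-h≡y-x : y + h + - x + - h ≡ y + - x
        y+h-x-h≡y-x = trans (cong (_+ - h) (xy∙z≈xz∙y y h (- x))) (//-rightDividesʳ h (y + - x))

    ∣H∣∣∣X∣ : ∀ X → Periodic H X → ∣ H ∣ ∣ ∣ X ∣
    ∣H∣∣∣X∣ X = go X (<-wellFounded ∣ X ∣)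
      where
      go : ∀ X → Acc _<_ ∣ X ∣ → Periodic H X → ∣ H ∣ ∣ ∣ X ∣
      go X (acc rec) X-periodic with nonempty? X
      ... | no X-empty = subst (∣ H ∣ ∣_) (sym (trans (cong ∣_∣ (Empty-unique X-empty)) (∣⊥∣≡0 n))) (∣ H ∣ ∣0)
      ... | yes (x , x∈X) = subst (∣ H ∣ ∣_) (sym ∣X∣≡∣X─C∣+∣C∣)
            (∣m∣n⇒∣m+n (go (X ─ C) (rec ∣X─C∣<∣X∣) (periodic─coset x X-periodic))
                       (∣-reflexive (sym (∣p⊖c∣≡∣p∣ H (- x)))))
        where
        C : Subset n
        C = H ⊕ x
        ∣X∣≡∣X─C∣+∣C∣ : ∣ X ∣ ≡ ∣ X ─ C ∣ ℕ.+ ∣ C ∣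
        ∣X∣≡∣X─C∣+∣C∣ = q⊆p⇒∣p∣≡∣p─q∣+∣q∣ (coset⊆ X-periodic x∈X)
        ∣X─C∣<∣X∣ : ∣ X ─ C ∣ < ∣ X ∣
        ∣X─C∣<∣X∣ = p∩q≢∅⇒∣p─q∣<∣p∣ X C (x , x∈p∩q⁺ (x∈X , ∈-⊖⁺ (subst (_∈ H) (sym (inverseʳ x)) has-zero)))

    lagrange : ∣ H ∣ ∣ n
    lagrange = subst (∣ H ∣ ∣_) (∣⊤∣≡n n) (∣H∣∣∣X∣ ⊤ (λ _ _ → ∈⊤))

  Period : Subset n → Fin n → Set
  Period B h = ∀ b → b ∈ B → b + h ∈ B

  period? : ∀ B → Decidable (Period B)
  period? B h = all? λ b → b ∈? B →-dec b + h ∈? B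

  period-+ : ∀ {B h h′} → Period B h → Period B h′ → Period B (h + h′)
  period-+ {B} {h} {h′} h-period h′-period b b∈B =
    subst (_∈ B) (assoc b h h′) (h′-period (b + h) (h-period b b∈B))

  stabilizer : Subset n → Subset n
  stabilizer B = fromDec λ h → period? B h ×-dec period? B (- h)

  ∈-stabilizer⁺ : ∀ {B h} → Period B h → Period B (- h) → h ∈ stabilizer B
  ∈-stabilizer⁺ {B} h-period -h-period = ∈-fromDec⁺ (λ h → period? B h ×-dec period? B (- h)) (h-period , -h-period)

  ∈-stabilizer⁻ : ∀ {B h} → h ∈ stabilizer B → Period B h × Period B (- h)
  ∈-stabilizer⁻ {B} = ∈-fromDec⁻ (λ h → period? B h ×-dec period? B (- h))

  stabilizer-isSubgroup : ∀ B → IsSubgroup (stabilizer B)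
  stabilizer-isSubgroup B = record
    { has-zero   = ∈-stabilizer⁺ 0#-period (subst (Period B) (sym ε⁻¹≈ε) 0#-period)
    ; add-closed = λ h∈S h′∈S →
        let (h-period , -h-period) = ∈-stabilizer⁻ h∈S
            (h′-period , -h′-period) = ∈-stabilizer⁻ h′∈S
        in ∈-stabilizer⁺ (period-+ h-period h′-period)
                         (subst (Period B) (⁻¹-∙-comm _ _) (period-+ -h-period -h′-period))
    ; neg-closed = λ h∈S →
        let (h-period , -h-period) = ∈-stabilizer⁻ h∈S
        in ∈-stabilizer⁺ -h-period (subst (Period B) (sym (⁻¹-involutive _)) h-period)
    }
    where
    0#-period : Period B 0#
    0#-period b b∈B = subst (_∈ B) (sym (identityʳ b)) b∈B

  stabilizer-periodic : ∀ B → Periodic (stabilizer B) B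
  stabilizer-periodic B b∈B h∈S = proj₁ (∈-stabilizer⁻ h∈S) _ b∈B

  Saturated : Subset n → Subset n → Set
  Saturated A B = ∀ {a a′ c} → a ∈ A → a′ ∈ A → a + c ∈ B → a′ + c ∈ B

  saturated⇒difference-period : ∀ {A B a a′} → Saturated A B → a ∈ A → a′ ∈ A → Period B (a′ + - a)
  saturated⇒difference-period {B = B} {a} {a′} saturated a∈A a′∈A b b∈B =
    subst (_∈ B) (x∙yz≈z∙xy a′ (- a) b)
      (saturated a∈A a′∈A (subst (_∈ B) (sym (\\-leftDividesˡ a b)) b∈B))

  saturated⇒∣A∣≤∣stabilizer∣ : ∀ {A B} → Saturated A B → Nonempty A → ∣ A ∣ ≤ ∣ stabilizer B ∣
  saturated⇒∣A∣≤∣stabilizer∣ {B = B} saturated (a , a∈A) =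
    injective⇒∣p∣≤∣q∣ (_+ - a) (+ʳ-injective (- a)) λ {a′} a′∈A →
      ∈-stabilizer⁺ (saturated⇒difference-period saturated a∈A a′∈A)
        (subst (Period B) (sym (⁻¹-anti-homo‿- a′ a)) (saturated⇒difference-period saturated a′∈A a∈A))

  eTransform-size : ∀ A B c → ∣ A ∣ ℕ.+ ∣ B ∣ ≤ ∣ A ∩ (B ⊖ c) ∣ ℕ.+ ∣ (A ⊕ c) ∪ B ∣
  eTransform-size A B c = begin
    ∣ A ∣ ℕ.+ ∣ B ∣                       ≡⟨ cong (ℕ._+ ∣ B ∣) (sym (∣p⊖c∣≡∣p∣ A (- c))) ⟩
    ∣ A ⊕ c ∣ ℕ.+ ∣ B ∣                   ≡⟨ sym (∣p∩q∣+∣p∪q∣≡∣p∣+∣q∣ (A ⊕ c) B) ⟩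
    ∣ (A ⊕ c) ∩ B ∣ ℕ.+ ∣ (A ⊕ c) ∪ B ∣       ≤⟨ +-monoˡ-≤ _ (injective⇒∣p∣≤∣q∣ (_+ - c) (+ʳ-injective (- c)) shift) ⟩
    ∣ A ∩ (B ⊖ c) ∣ ℕ.+ ∣ (A ⊕ c) ∪ B ∣       ∎
    where
    open ≤-Reasoning
    shift : ∀ {x} → x ∈ (A ⊕ c) ∩ B → x + - c ∈ A ∩ (B ⊖ c)
    shift {x} x∈A⊕c∩B = let (x∈A⊕c , x∈B) = x∈p∩q⁻ (A ⊕ c) B x∈A⊕c∩B in
      x∈p∩q⁺ (∈-⊖⁻ x∈A⊕c , ∈-⊖⁺ (subst (_∈ B) (sym (//-rightDividesˡ c x)) x∈B))

  eTransform-sumset⊆ : ∀ A B c → sumset (A ∩ (B ⊖ c)) ((A ⊕ c) ∪ B) ⊆ sumset A B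
  eTransform-sumset⊆ A B c x∈ with ∈-sumset⁻ x∈
  ... | a , b , a∈A∩B⊖c , b∈A⊕c∪B , refl with x∈p∩q⁻ A (B ⊖ c) a∈A∩B⊖c | x∈p∪q⁻ (A ⊕ c) B b∈A⊕c∪B
  ... | a∈A , _     | inj₂ b∈B   = ∈-sumset⁺ a∈A b∈B
  ... | _ , a∈B⊖c   | inj₁ b∈A⊕c =
    subst (_∈ sumset A B) (trans (x∙yz≈y∙xz (b + - c) a c) (cong (a +_) (//-rightDividesˡ c b)))
      (∈-sumset⁺ (∈-⊖⁻ b∈A⊕c) (∈-⊖⁻ a∈B⊖c))

  record Saturation (A B : Subset n) : Set where
    field
      A* B*       : Subset n
      A*-nonempty : Nonempty A*
      B⊆B*        : B ⊆ B*
      sumset⊆     : sumset A* B* ⊆ sumset A B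
      size≤       : ∣ A ∣ ℕ.+ ∣ B ∣ ≤ ∣ A* ∣ ℕ.+ ∣ B* ∣
      saturated   : Saturated A* B*

  saturation-transfer : ∀ {A B A′ B′} → B ⊆ B′ → sumset A′ B′ ⊆ sumset A B →
                        ∣ A ∣ ℕ.+ ∣ B ∣ ≤ ∣ A′ ∣ ℕ.+ ∣ B′ ∣ → Saturation A′ B′ → Saturation A B
  saturation-transfer B⊆B′ sumset′⊆sumset size≤size′ s = record
    { A*          = A*
    ; B*          = B*
    ; A*-nonempty = A*-nonempty
    ; B⊆B*        = ⊆-trans B⊆B′ B⊆B*
    ; sumset⊆     = ⊆-trans sumset⊆ sumset′⊆sumset
    ; size≤       = ≤-trans size≤size′ size≤
    ; saturated   = saturated
    }
    where open Saturation s

  unsaturated? : ∀ A B → Dec (∃ λ c → ∃₂ λ a a′ → a ∈ A × a′ ∈ A × a + c ∈ B × a′ + c ∉ B)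
  unsaturated? A B = any? λ c → any? λ a → any? λ a′ →
    a ∈? A ×-dec a′ ∈? A ×-dec a + c ∈? B ×-dec ¬? (a′ + c ∈? B)

  saturation : ∀ A B → Nonempty A → Saturation A B
  saturation A B = go A B (<-wellFounded ∣ A ∣)
    where
    go : ∀ A B → Acc _<_ ∣ A ∣ → Nonempty A → Saturation A B
    go A B (acc rec) A-nonempty with unsaturated? A B
    ... | no ¬unsaturated = record
      { A*          = A
      ; B*          = B
      ; A*-nonempty = A-nonempty
      ; B⊆B*        = ⊆-refl
      ; sumset⊆     = ⊆-refl
      ; size≤       = ≤-refl
      ; saturated   = λ {a} {a′} {c} a∈A a′∈A a+c∈B → decidable-stable (a′ + c ∈? B)
          λ a′+c∉B → ¬unsaturated (c , a , a′ , a∈A , a′∈A , a+c∈B , a′+c∉B)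
      }
    ... | yes (c , a , a′ , a∈A , a′∈A , a+c∈B , a′+c∉B) =
      saturation-transfer (q⊆p∪q (A ⊕ c) B) (eTransform-sumset⊆ A B c) (eTransform-size A B c)
        (go (A ∩ (B ⊖ c)) ((A ⊕ c) ∪ B) (rec ∣A′∣<∣A∣) (a , x∈p∩q⁺ (a∈A , ∈-⊖⁺ a+c∈B)))
      where
      ∣A′∣<∣A∣ : ∣ A ∩ (B ⊖ c) ∣ < ∣ A ∣
      ∣A′∣<∣A∣ = p⊂q⇒∣p∣<∣q∣ (p∩q⊆p A (B ⊖ c) , a′ , a′∈A , a′+c∉B ∘ ∈-⊖⁻ ∘ proj₂ ∘ x∈p∩q⁻ A (B ⊖ c))

  MeetsCoset : Subset n → Subset n → Fin n → Set
  MeetsCoset B H x = ∃₂ λ b h → b ∈ B × h ∈ H × b ≡ x + h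

  periodic⇒⊤⊆ : ∀ {H B X} → IsSubgroup H → Periodic H X → B ⊆ X → (∀ x → MeetsCoset B H x) → ⊤ ⊆ X
  periodic⇒⊤⊆ {X = X} H-subgroup X-periodic B⊆X meets {x} _ with meets x
  ... | b , h , b∈B , h∈H , refl =
    subst (_∈ X) (//-rightDividesʳ h x) (X-periodic (B⊆X b∈B) (IsSubgroup.neg-closed H-subgroup h∈H))

open import Defs

module _ (Q : ℕ) .{{_ : NonZero Q}} where
  open import Algebra.Definitions {A = Fin Q} _≡_ using (Associative; Commutative; LeftIdentity; RightIdentity; LeftInverse; RightInverse)
  open import Data.Nat.Base using (_+_; _∸_; _%_)
  open import Data.Nat.DivMod using (_mod_; m%n<n; %-distribˡ-+; m%n%n≡m%n; m<n⇒m%n≡m; n%n≡0; m*n%n≡0)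
  open ≡-Reasoning

  private
    toℕ-mod : ∀ m → toℕ (m mod Q) ≡ m % Q
    toℕ-mod m = toℕ-fromℕ< (m%n<n m Q)

    mod-cong : ∀ {m m′} → m % Q ≡ m′ % Q → m mod Q ≡ m′ mod Q
    mod-cong {m} {m′} eq = toℕ-injective (trans (toℕ-mod m) (trans eq (sym (toℕ-mod m′))))

    mod-toℕ : ∀ (a : Fin Q) → toℕ a mod Q ≡ a
    mod-toℕ a = toℕ-injective (trans (toℕ-mod (toℕ a)) (m<n⇒m%n≡m (toℕ<n a)))

    mod-absorbˡ : ∀ m k → (toℕ (m mod Q) + k) mod Q ≡ (m + k) mod Q
    mod-absorbˡ m k = mod-cong (begin
      (toℕ (m mod Q) + k) % Q  ≡⟨ cong (λ t → (t + k) % Q) (toℕ-mod m) ⟩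
      (m % Q + k) % Q          ≡⟨ %-distribˡ-+ (m % Q) k Q ⟩
      (m % Q % Q + k % Q) % Q  ≡⟨ cong (λ t → (t + k % Q) % Q) (m%n%n≡m%n m Q) ⟩
      (m % Q + k % Q) % Q      ≡⟨ %-distribˡ-+ m k Q ⟨
      (m + k) % Q              ∎)

  addQ-comm : Commutative (addQ Q)
  addQ-comm a b = cong (_mod Q) (ℕ.+-comm (toℕ a) (toℕ b))

  addQ-assoc : Associative (addQ Q)
  addQ-assoc a b c = begin
    addQ Q (addQ Q a b) c                ≡⟨ mod-absorbˡ (toℕ a + toℕ b) (toℕ c) ⟩
    (toℕ a + toℕ b + toℕ c) mod Q        ≡⟨ cong (_mod Q) (ℕ.+-assoc (toℕ a) (toℕ b) (toℕ c)) ⟩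
    (toℕ a + (toℕ b + toℕ c)) mod Q      ≡⟨ cong (_mod Q) (ℕ.+-comm (toℕ a) (toℕ b + toℕ c)) ⟩
    (toℕ b + toℕ c + toℕ a) mod Q        ≡⟨ mod-absorbˡ (toℕ b + toℕ c) (toℕ a) ⟨
    addQ Q (addQ Q b c) a                ≡⟨ addQ-comm (addQ Q b c) a ⟩
    addQ Q a (addQ Q b c)                ∎

  addQ-identityˡ : LeftIdentity (zeroQ Q) (addQ Q)
  addQ-identityˡ a = trans (mod-absorbˡ 0 (toℕ a)) (mod-toℕ a)

  addQ-identityʳ : RightIdentity (zeroQ Q) (addQ Q)
  addQ-identityʳ a = trans (addQ-comm a (zeroQ Q)) (addQ-identityˡ a)

  addQ-inverseˡ : LeftInverse (zeroQ Q) (negQ Q) (addQ Q)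
  addQ-inverseˡ a = begin
    addQ Q (negQ Q a) a       ≡⟨ mod-absorbˡ (Q ∸ toℕ a) (toℕ a) ⟩
    (Q ∸ toℕ a + toℕ a) mod Q ≡⟨ cong (_mod Q) (ℕ.m∸n+n≡m (ℕ.<⇒≤ (toℕ<n a))) ⟩
    Q mod Q                   ≡⟨ mod-cong (trans (n%n≡0 Q) (sym (m*n%n≡0 0 Q))) ⟩
    zeroQ Q                   ∎

  addQ-inverseʳ : RightInverse (zeroQ Q) (negQ Q) (addQ Q)
  addQ-inverseʳ a = trans (addQ-comm a (negQ Q a)) (addQ-inverseˡ a)

  addQ-isAbelianGroup : IsAbelianGroup _≡_ (addQ Q) (zeroQ Q) (negQ Q)
  addQ-isAbelianGroup = record
    { isGroup = record
      { isMonoid = record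
        { isSemigroup = record
          { isMagma = record { isEquivalence = isEquivalence ; ∙-cong = cong₂ (addQ Q) }
          ; assoc   = addQ-assoc
          }
        ; identity = addQ-identityˡ , addQ-identityʳ
        }
      ; inverse = addQ-inverseˡ , addQ-inverseʳ
      ; ⁻¹-cong = cong (negQ Q)
      }
    ; comm = addQ-comm
    }

open import Data.Rational.Base using (ℚ; 0ℚ; 1ℚ; _<_; _≤_; _+_; _-_; _*_)
open import Data.Rational.Properties using (≤-trans; ≮⇒≥; _<?_)

module _ where
  open import Data.Rational.Base using (mkℚ; -_; _/_; *≤*; Positive)
  open import Data.Rational.Properties
    using (normalize-coprime; +-monoˡ-≤; +-monoˡ-<; *-identityˡ; *-cancelʳ-≤-pos
          ; +-0-abelianGroup; *-1-commutativeMonoid; module ≤-Reasoning)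
  import Data.Integer.Base as ℤ
  import Data.Integer.Properties as ℤ
  import Data.Nat.Coprimality as Coprime
  open import Algebra.Properties.AbelianGroup +-0-abelianGroup using (xyx⁻¹≈y)
  open import Algebra.Properties.CommutativeSemigroup
    (CommutativeMonoid.commutativeSemigroup *-1-commutativeMonoid) using (xy∙z≈y∙zx)

  ℕtoℚ≡mkℚ : ∀ n → ℕtoℚ n ≡ mkℚ (ℤ.+ n) 0 (Coprime.sym (Coprime.1-coprimeTo n))
  ℕtoℚ≡mkℚ n = normalize-coprime _

  ℕtoℚ-+ : ∀ m n → ℕtoℚ (m ℕ.+ n) ≡ ℕtoℚ m + ℕtoℚ n
  ℕtoℚ-+ m n = trans (cong (_/ 1) (cong₂ ℤ._+_ (sym (ℤ.*-identityʳ (ℤ.+ m))) (sym (ℤ.*-identityʳ (ℤ.+ n)))))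
                     (sym (cong₂ _+_ (ℕtoℚ≡mkℚ m) (ℕtoℚ≡mkℚ n)))

  ℕtoℚ-* : ∀ m n → ℕtoℚ (m ℕ.* n) ≡ ℕtoℚ m * ℕtoℚ n
  ℕtoℚ-* m n = trans (cong (_/ 1) (ℤ.pos-* m n)) (sym (cong₂ _*_ (ℕtoℚ≡mkℚ m) (ℕtoℚ≡mkℚ n)))

  ℕtoℚ-mono-≤ : ∀ {m n} → m ℕ.≤ n → ℕtoℚ m ≤ ℕtoℚ n
  ℕtoℚ-mono-≤ {m} {n} m≤n rewrite ℕtoℚ≡mkℚ m | ℕtoℚ≡mkℚ n = *≤* (ℤ.*-monoʳ-≤-nonNeg (ℤ.+ 1) (ℤ.+≤+ m≤n))

  ℕtoℚ-suc-positive : ∀ n → Positive (ℕtoℚ (ℕ.suc n))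
  ℕtoℚ-suc-positive n = subst Positive (sym (ℕtoℚ≡mkℚ (ℕ.suc n))) _

  m+n≤o+p∧o<q⇒m+n-q<p : ∀ {m n o p} {q : ℚ} → m ℕ.+ n ℕ.≤ o ℕ.+ p → ℕtoℚ o < q →
                         ℕtoℚ m + ℕtoℚ n - q < ℕtoℚ p
  m+n≤o+p∧o<q⇒m+n-q<p {m} {n} {o} {p} {q} m+n≤o+p o<q = begin-strict
    ℕtoℚ m + ℕtoℚ n - q    ≡⟨ cong (_- q) (ℕtoℚ-+ m n) ⟨
    ℕtoℚ (m ℕ.+ n) - q     ≤⟨ +-monoˡ-≤ (- q) (ℕtoℚ-mono-≤ m+n≤o+p) ⟩
    ℕtoℚ (o ℕ.+ p) - q     ≡⟨ cong (_- q) (ℕtoℚ-+ o p) ⟩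
    ℕtoℚ o + ℕtoℚ p - q    <⟨ +-monoˡ-< (- q) (+-monoˡ-< (ℕtoℚ p) o<q) ⟩
    q + ℕtoℚ p - q         ≡⟨ xyx⁻¹≈y q (ℕtoℚ p) ⟩
    ℕtoℚ p                 ∎
    where open ≤-Reasoning

  m*k≡n∧εn≤m⇒kε≤1 : ∀ {m k n} {ε : ℚ} .{{_ : NonZero n}} → m ℕ.* k ≡ n → ε * ℕtoℚ n ≤ ℕtoℚ m →
                     ℕtoℚ k * ε ≤ 1ℚ
  m*k≡n∧εn≤m⇒kε≤1 {ℕ.zero} {n = n} refl _ = ⊥-elim (ℕ.≢-nonZero⁻¹ n refl)
  m*k≡n∧εn≤m⇒kε≤1 {m@(ℕ.suc m-1)} {k} {ε = ε} refl εn≤m =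
    *-cancelʳ-≤-pos (ℕtoℚ m) {{ℕtoℚ-suc-positive m-1}} (begin
      ℕtoℚ k * ε * ℕtoℚ m       ≡⟨ xy∙z≈y∙zx (ℕtoℚ k) ε (ℕtoℚ m) ⟩
      ε * (ℕtoℚ m * ℕtoℚ k)     ≡⟨ cong (ε *_) (ℕtoℚ-* m k) ⟨
      ε * ℕtoℚ (m ℕ.* k)        ≤⟨ εn≤m ⟩
      ℕtoℚ m                    ≡⟨ *-identityˡ (ℕtoℚ m) ⟨
      1ℚ * ℕtoℚ m               ∎)
    where open ≤-Reasoning

theorem4p4 : (ε : ℚ) → 0ℚ < ε → (Q : ℕ) .{{_ : NonZero Q}} →
    (A B : Subset Q) → Nonempty A → Nonempty B →
    ((H : Subset Q) → IsSubgroup Q H → (k : ℕ) → HasIndex Q H k →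
    ℕtoℚ k * ε ≤ 1ℚ → (x : Fin Q) → MeetsCoset Q B H x) →
    (ℕtoℚ ∣ A ∣ + ℕtoℚ ∣ B ∣ - ε * ℕtoℚ Q < ℕtoℚ ∣ sumset Q A B ∣)
    ⊎ (sumset Q A B ≡ ⊤)
theorem4p4 ε _ Q A B A-nonempty _ B-meets-cosets =
  Sum.map A*-small⇒bound A*-large⇒full (toSum (ℕtoℚ ∣ A* ∣ <? ε * ℕtoℚ Q))
  where
  module G = FiniteAbelianGroup (addQ-isAbelianGroup Q)
  open G.Saturation (G.saturation A B A-nonempty)

  S : Subset Q
  S = G.stabilizer B*

  open Divisibility._∣_ (G.lagrange (G.stabilizer-isSubgroup B*))
    renaming (quotient to k; equality to Q≡k*∣S∣)

  S-index : HasIndex Q S k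
  S-index = trans (ℕ.*-comm ∣ S ∣ k) (sym Q≡k*∣S∣)

  S-subgroup : IsSubgroup Q S
  S-subgroup = record { has-zero = has-zero ; add-closed = add-closed ; neg-closed = neg-closed }
    where open G.IsSubgroup (G.stabilizer-isSubgroup B*)

  A*-small⇒bound : ℕtoℚ ∣ A* ∣ < ε * ℕtoℚ Q →
                   ℕtoℚ ∣ A ∣ + ℕtoℚ ∣ B ∣ - ε * ℕtoℚ Q < ℕtoℚ ∣ sumset Q A B ∣
  A*-small⇒bound = m+n≤o+p∧o<q⇒m+n-q<p {∣ A ∣} {∣ B ∣} {∣ A* ∣} {∣ sumset Q A B ∣}
    (ℕ.≤-trans size≤ (ℕ.+-monoʳ-≤ ∣ A* ∣ ∣B*∣≤∣sumset∣))
    where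
    ∣B*∣≤∣sumset∣ : ∣ B* ∣ ℕ.≤ ∣ sumset Q A B ∣
    ∣B*∣≤∣sumset∣ = ℕ.≤-trans (G.∣B∣≤∣sumset∣ A*-nonempty) (p⊆q⇒∣p∣≤∣q∣ sumset⊆)

  A*-large⇒full : ¬ (ℕtoℚ ∣ A* ∣ < ε * ℕtoℚ Q) → sumset Q A B ≡ ⊤
  A*-large⇒full A*-large = ⊆-antisym ⊆⊤ (⊆-trans (G.⊤⊆sumset A*-nonempty ⊤⊆B*) sumset⊆)
    where
    kε≤1 : ℕtoℚ k * ε ≤ 1ℚ
    kε≤1 = m*k≡n∧εn≤m⇒kε≤1 {∣ S ∣} {k} S-index
      (≤-trans (≮⇒≥ A*-large) (ℕtoℚ-mono-≤ {∣ A* ∣} (G.saturated⇒∣A∣≤∣stabilizer∣ saturated A*-nonempty)))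
    ⊤⊆B* : ⊤ ⊆ B*
    ⊤⊆B* = G.periodic⇒⊤⊆ (G.stabilizer-isSubgroup B*) (G.stabilizer-periodic B*) B⊆B*
      (B-meets-cosets S S-subgroup k S-index kε≤1)
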